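{- Let $G$ be a finite simple graph that is a König–Egerváry graph. Then \[ d(G)=|\mathrm{core}(G)|-|N(\mathrm{core}(G))|=\alpha(G)-\mu(G)=\mathrm{def}(G). \]
   Context: A set of vertices is independent if no two of its vertices are adjacent; $\mathrm{Ind}(G)$ is the family of independent sets of $G$, $\alpha(G)$ is the maximum size of an independent set, and $\Omega(G)$ is the family of independent sets of size $\alpha(G)$. $\mathrm{core}(G)=\bigcap\{S : S\in\Omega(G)\}$. For $A\subseteq V(G)$, $N(A)$ is the set of vertices adjacent to some vertex of $A$. $\mu(G)$ is the size of a maximum matching of $G$. $G$ is a König–Egerváry graph if $\alpha(G)+\mu(G)=|V(G)|$. The critical difference is $d(G)=\max\{|S|-|N(S)| : S\in\mathrm{Ind}(G)\}$. The deficiency is $\mathrm{def}(G)=|V(G)|-2\mu(G)$. -}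

module Defs where

open import Data.Nat using (ℕ; zero; suc; _≤_)
open import Data.Bool using (Bool; true; false; _∧_; _∨_; T)
open import Data.Fin using (Fin; zero; suc)
open import Data.Fin.Subset using (Subset; _∈_; ∣_∣)
open import Data.Vec using (tabulate)
open import Data.Product using (Σ; _×_; proj₁; proj₂)
open import Data.Sum using (_⊎_; inj₁; inj₂; [_,_])
open import Data.Integer using (ℤ; +_; _-_)
open import Relation.Nullary using (¬_)
open import Relation.Binary.PropositionalEquality using (_≡_)
open import Function.Definitions using (Injective)

record Graph (n : ℕ) : Set where
  field
    adj   : Fin n → Fin n → Bool
    sym   : ∀ u v → adj u v ≡ adj v u
    irrefl : ∀ v → adj v v ≡ false

open Graph public

Adj : ∀ {n} → Graph n → Fin n → Fin n → Set
Adj G u v = T (adj G u v)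

anyFin : ∀ {n} → (Fin n → Bool) → Bool
anyFin {zero}  f = false
anyFin {suc n} f = f zero ∨ anyFin (λ i → f (suc i))

N : ∀ {n} → Graph n → Subset n → Subset n
N G A = tabulate λ v → anyFin λ u → Data.Vec.lookup A u ∧ adj G u v
  where import Data.Vec

Independent : ∀ {n} → Graph n → Subset n → Set
Independent G S = ∀ u v → u ∈ S → v ∈ S → ¬ Adj G u v

IsAlpha : ∀ {n} → Graph n → ℕ → Set
IsAlpha G a = Σ _ (λ S → Independent G S × ∣ S ∣ ≡ a)
            × (∀ S → Independent G S → ∣ S ∣ ≤ a)

IsMaxIndep : ∀ {n} → Graph n → ℕ → Subset n → Set
IsMaxIndep G a S = Independent G S × ∣ S ∣ ≡ a

IsCore : ∀ {n} → Graph n → ℕ → Subset n → Set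
IsCore G a C = ∀ v → (v ∈ C → ∀ S → IsMaxIndep G a S → v ∈ S)
                   × ((∀ S → IsMaxIndep G a S → v ∈ S) → v ∈ C)

-- a matching of size k: k edges (e i = (x,y), x adjacent to y) whose 2k endpoints are distinct
IsMatching : ∀ {n} → Graph n → (k : ℕ) → (Fin k → Fin n × Fin n) → Set
IsMatching G k e =
  (∀ i → Adj G (proj₁ (e i)) (proj₂ (e i)))
  × Injective _≡_ _≡_ [ (λ i → proj₁ (e i)) , (λ i → proj₂ (e i)) ]

HasMatching : ∀ {n} → Graph n → ℕ → Set
HasMatching G k = Σ _ (IsMatching G k)

IsMu : ∀ {n} → Graph n → ℕ → Set
IsMu G m = HasMatching G m × (∀ k → HasMatching G k → k ≤ m)

IsCritDiff : ∀ {n} → Graph n → ℤ → Set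
IsCritDiff G d = Σ _ (λ S → Independent G S × (+ ∣ S ∣ - + ∣ N G S ∣) ≡ d)
               × (∀ S → Independent G S → (+ ∣ S ∣ - + ∣ N G S ∣) Data.Integer.≤ d)
  where import Data.Integer

-- In every graph, the vertices of an independent set S that are covered by a maximum matching M are
-- matched to distinct vertices of N(S), and at most n − 2μ vertices are uncovered; so |S| − |N(S)|
-- ≤ n − 2μ, which is α − μ for a König–Egerváry graph. Conversely, α + μ = n says that every
-- maximum independent set S misses exactly μ vertices, so M matches V ∖ S into S. Hence every
-- vertex outside the core is covered, and the partner of a vertex of N(core) lies in every maximum
-- independent set, that is, in the core. Trading the vertices of T ∖ core (T maximum independent)
-- for their partners then gives α + |N(core)| ≤ |core| + μ. The core is independent, so d(G) is
-- squeezed between the two bounds.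

module Submission where

open import Defs renaming (sym to adj-sym)
open import Data.Nat using (ℕ; suc; _+_; _*_; _∸_; _≤_; z≤n)
import Data.Nat.Properties as ℕ
open import Data.Bool using (Bool; T; _∧_)
open import Data.Bool.Properties using (T-≡; T-∧; T-∨)
open import Data.Fin using (Fin; zero; suc; splitAt; join)
open import Data.Fin.Properties using (any?; _≟_; suc-injective; join-splitAt)
open import Data.Fin.Subset
  using (Subset; inside; outside; _∈_; _∉_; ∣_∣; _∪_; _∩_; _─_; ∁; ⁅_⁆; ⊤; Empty)
open import Data.Fin.Subset.Properties
  using ( _∈?_; ∣p∣≤n; ∣⊤∣≡n; ∣∁p∣≡n∸∣p∣; ∣⊥∣≡0; Empty-unique; x∈⁅y⁆⇒x≡y; x∈p∧x∉q⇒x∈p─q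
        ; x∈p⇒∣p-x∣<∣p∣; x∉p⇒x∈∁p; x∈p∪q⁺; x∈p∪q⁻; x∈p∩q⁻ )
open import Data.Vec using (_∷_; []; lookup; tabulate; here; there)
open import Data.Vec.Properties using (lookup∘tabulate; []=⇒lookup; lookup⇒[]=)
open import Data.Product using (_×_; _,_; proj₁; proj₂; ∃; ∃-syntax)
open import Data.Sum using (_⊎_; inj₁; inj₂; [_,_]; swap)
open import Data.Sum.Properties using (swap-involutive)
open import Function using (_∘_; id)
open import Function.Bundles using (module Equivalence)
open import Function.Definitions using (Injective)
open import Relation.Nullary using (¬_; Dec; yes; no; contradiction)
open import Relation.Nullary.Decidable using (isYes; map′; _⊎-dec_; toWitness; fromWitness)
open import Relation.Binary.PropositionalEquality hiding ([_])

open Equivalence using (to; from)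

∣p∪q∣+∣p∩q∣≡∣p∣+∣q∣ : ∀ {n} (p q : Subset n) → ∣ p ∪ q ∣ + ∣ p ∩ q ∣ ≡ ∣ p ∣ + ∣ q ∣
∣p∪q∣+∣p∩q∣≡∣p∣+∣q∣ []            []            = refl
∣p∪q∣+∣p∩q∣≡∣p∣+∣q∣ (inside  ∷ p) (inside  ∷ q) = cong suc (begin
  ∣ p ∪ q ∣ + suc ∣ p ∩ q ∣   ≡⟨ ℕ.+-suc _ _ ⟩
  suc (∣ p ∪ q ∣ + ∣ p ∩ q ∣) ≡⟨ cong suc (∣p∪q∣+∣p∩q∣≡∣p∣+∣q∣ p q) ⟩
  suc (∣ p ∣ + ∣ q ∣)         ≡⟨ ℕ.+-suc _ _ ⟨
  ∣ p ∣ + suc ∣ q ∣           ∎)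
  where open ≡-Reasoning
∣p∪q∣+∣p∩q∣≡∣p∣+∣q∣ (inside  ∷ p) (outside ∷ q) = cong suc (∣p∪q∣+∣p∩q∣≡∣p∣+∣q∣ p q)
∣p∪q∣+∣p∩q∣≡∣p∣+∣q∣ (outside ∷ p) (inside  ∷ q) =
  trans (cong suc (∣p∪q∣+∣p∩q∣≡∣p∣+∣q∣ p q)) (sym (ℕ.+-suc _ _))
∣p∪q∣+∣p∩q∣≡∣p∣+∣q∣ (outside ∷ p) (outside ∷ q) = ∣p∪q∣+∣p∩q∣≡∣p∣+∣q∣ p q

∣p∪q∣≤∣p∣+∣q∣ : ∀ {n} (p q : Subset n) → ∣ p ∪ q ∣ ≤ ∣ p ∣ + ∣ q ∣
∣p∪q∣≤∣p∣+∣q∣ p q =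
  ℕ.≤-trans (ℕ.m≤m+n _ _) (ℕ.≤-reflexive (∣p∪q∣+∣p∩q∣≡∣p∣+∣q∣ p q))

∣p∪q∣≡∣p∣+∣q∣ : ∀ {n} (p q : Subset n) → Empty (p ∩ q) → ∣ p ∪ q ∣ ≡ ∣ p ∣ + ∣ q ∣
∣p∪q∣≡∣p∣+∣q∣ {n} p q disjoint = begin
  ∣ p ∪ q ∣             ≡⟨ ℕ.+-identityʳ _ ⟨
  ∣ p ∪ q ∣ + 0         ≡⟨ cong (∣ p ∪ q ∣ +_) ∣p∩q∣≡0 ⟨
  ∣ p ∪ q ∣ + ∣ p ∩ q ∣ ≡⟨ ∣p∪q∣+∣p∩q∣≡∣p∣+∣q∣ p q ⟩
  ∣ p ∣ + ∣ q ∣         ∎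
  where
  open ≡-Reasoning
  ∣p∩q∣≡0 : ∣ p ∩ q ∣ ≡ 0
  ∣p∩q∣≡0 = trans (cong ∣_∣ (Empty-unique disjoint)) (∣⊥∣≡0 n)

∣p∣+k≡n⇒∣∁p∣≡k : ∀ {n k} (p : Subset n) → ∣ p ∣ + k ≡ n → ∣ ∁ p ∣ ≡ k
∣p∣+k≡n⇒∣∁p∣≡k p ∣p∣+k≡n =
  trans (∣∁p∣≡n∸∣p∣ p) (trans (cong (_∸ ∣ p ∣) (sym ∣p∣+k≡n)) (ℕ.m+n∸m≡n ∣ p ∣ _))

∣p∣≤∣q∣-by-injection : ∀ {k n} {p : Subset k} {q : Subset n} (R : Fin k → Fin n → Set) →
                       (∀ {v} → v ∈ p → ∃[ w ] w ∈ q × R v w) →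
                       (∀ {v v′ w} → v ∈ p → v′ ∈ p → R v w → R v′ w → v ≡ v′) →
                       ∣ p ∣ ≤ ∣ q ∣
∣p∣≤∣q∣-by-injection {p = []} R total injective = z≤n
∣p∣≤∣q∣-by-injection {p = outside ∷ p} R total injective =
  ∣p∣≤∣q∣-by-injection (R ∘ suc) (total ∘ there)
    (λ v∈p v′∈p r r′ → suc-injective (injective (there v∈p) (there v′∈p) r r′))
∣p∣≤∣q∣-by-injection {p = inside ∷ p} {q} R total injective with total here
... | w₀ , w₀∈q , r₀ =
  ℕ.≤-<-trans (∣p∣≤∣q∣-by-injection (R ∘ suc) total′ injective′) (x∈p⇒∣p-x∣<∣p∣ w₀∈q)
  where
  injective′ : ∀ {v v′ w} → v ∈ p → v′ ∈ p → R (suc v) w → R (suc v′) w → v ≡ v′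
  injective′ v∈p v′∈p r r′ = suc-injective (injective (there v∈p) (there v′∈p) r r′)

  total′ : ∀ {v} → v ∈ p → ∃[ w ] w ∈ q ─ ⁅ w₀ ⁆ × R (suc v) w
  total′ v∈p with total (there v∈p)
  ... | w , w∈q , r = w , x∈p∧x∉q⇒x∈p─q w∈q w∉⁅w₀⁆ , r
    where
    w∉⁅w₀⁆ : w ∉ ⁅ w₀ ⁆
    w∉⁅w₀⁆ w∈⁅w₀⁆ with x∈⁅y⁆⇒x≡y w₀ w∈⁅w₀⁆
    ... | refl with injective (there v∈p) here r r₀
    ... | ()

k≤∣q∣-by-injection : ∀ {k n} {q : Subset n} (f : Fin k → Fin n) →
                     Injective _≡_ _≡_ f → (∀ i → f i ∈ q) → k ≤ ∣ q ∣
k≤∣q∣-by-injection {k} f f-injective f∈q =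
  subst (_≤ _) (∣⊤∣≡n k)
    (∣p∣≤∣q∣-by-injection {p = ⊤} (λ i w → f i ≡ w) (λ {i} _ → f i , f∈q i , refl)
      (λ _ _ fi≡w fi′≡w → f-injective (trans fi≡w (sym fi′≡w))))

injection⇒onto : ∀ {k n} {q : Subset n} (f : Fin k → Fin n) →
                 Injective _≡_ _≡_ f → (∀ i → f i ∈ q) → ∣ q ∣ ≡ k →
                 ∀ {v} → v ∈ q → ∃[ i ] f i ≡ v
injection⇒onto {k} f f-injective f∈q ∣q∣≡k {v} v∈q with any? (λ i → f i ≟ v)
... | yes hit = hit
... | no miss =
  contradiction (subst (suc k ≤_) ∣q∣≡k (k≤∣q∣-by-injection g g-injective g∈q)) (ℕ.1+n≰n)
  where
  g : Fin (suc k) → Fin _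
  g zero    = v
  g (suc i) = f i

  g∈q : ∀ i → g i ∈ _
  g∈q zero    = v∈q
  g∈q (suc i) = f∈q i

  g-injective : Injective _≡_ _≡_ g
  g-injective {zero}  {zero}  _  = refl
  g-injective {zero}  {suc j} eq = contradiction (j , sym eq) miss
  g-injective {suc i} {zero}  eq = contradiction (i , eq) miss
  g-injective {suc i} {suc j} eq = cong suc (f-injective eq)

T⇒∈ : ∀ {n} {p : Subset n} {v} → T (lookup p v) → v ∈ p
T⇒∈ {p = p} {v} t = lookup⇒[]= v p (to T-≡ t)

∈⇒T : ∀ {n} {p : Subset n} {v} → v ∈ p → T (lookup p v)
∈⇒T v∈p = from T-≡ ([]=⇒lookup v∈p)

∈tabulate⁺ : ∀ {n} {f : Fin n → Bool} {v} → T (f v) → v ∈ tabulate f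
∈tabulate⁺ {f = f} {v} t = T⇒∈ (subst T (sym (lookup∘tabulate f v)) t)

∈tabulate⁻ : ∀ {n} {f : Fin n → Bool} {v} → v ∈ tabulate f → T (f v)
∈tabulate⁻ {f = f} {v} v∈ = subst T (lookup∘tabulate f v) (∈⇒T v∈)

anyFin⁺ : ∀ {n} (f : Fin n → Bool) {i} → T (f i) → T (anyFin f)
anyFin⁺ f {zero}  t = from T-∨ (inj₁ t)
anyFin⁺ f {suc i} t = from T-∨ (inj₂ (anyFin⁺ (f ∘ suc) t))

anyFin⁻ : ∀ {n} (f : Fin n → Bool) → T (anyFin f) → ∃[ i ] T (f i)
anyFin⁻ {suc n} f t with to T-∨ t
... | inj₁ t₀ = zero , t₀
... | inj₂ t₁ with anyFin⁻ (f ∘ suc) t₁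
...   | i , tᵢ = suc i , tᵢ

module _ {n} (G : Graph n) where

  ∈N⁺ : ∀ {S u v} → u ∈ S → Adj G u v → v ∈ N G S
  ∈N⁺ {S} {u} {v} u∈S u~v =
    ∈tabulate⁺ (anyFin⁺ (λ x → lookup S x ∧ adj G x v) (from T-∧ (∈⇒T u∈S , u~v)))

  ∈N⁻ : ∀ {S v} → v ∈ N G S → ∃[ u ] u ∈ S × Adj G u v
  ∈N⁻ v∈NS with anyFin⁻ _ (∈tabulate⁻ v∈NS)
  ... | u , t = u , T⇒∈ (proj₁ (to T-∧ t)) , proj₂ (to T-∧ t)

splitAt-injective : ∀ m {n} → Injective _≡_ _≡_ (splitAt m {n})
splitAt-injective m {n} {i} {j} eq =
  trans (sym (join-splitAt m n i)) (trans (cong (join m n) eq) (join-splitAt m n j))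

swap≢id : ∀ {A : Set} (j : A ⊎ A) → swap j ≢ j
swap≢id (inj₁ _) ()
swap≢id (inj₂ _) ()

edge : ∀ {m} → Fin m ⊎ Fin m → Fin m
edge = [ id , id ]

edge∘swap : ∀ {m} (j : Fin m ⊎ Fin m) → edge (swap j) ≡ edge j
edge∘swap (inj₁ _) = refl
edge∘swap (inj₂ _) = refl

module Matching {n} (G : Graph n) {m} (e : Fin m → Fin n × Fin n) (M : IsMatching G m e) where

  end : Fin m ⊎ Fin m → Fin n
  end = [ proj₁ ∘ e , proj₂ ∘ e ]

  end-injective : Injective _≡_ _≡_ end
  end-injective = proj₂ M

  end-adjacent : ∀ j → Adj G (end j) (end (swap j))
  end-adjacent (inj₁ i) = proj₁ M i
  end-adjacent (inj₂ i) = subst T (adj-sym G _ _) (proj₁ M i)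

  MatchedTo : Fin n → Fin n → Set
  MatchedTo v w = ∃[ j ] end j ≡ v × end (swap j) ≡ w

  Covered : Fin n → Set
  Covered v = ∃ (MatchedTo v)

  matchedTo-sym : ∀ {v w} → MatchedTo v w → MatchedTo w v
  matchedTo-sym (j , refl , refl) = swap j , refl , cong end (swap-involutive j)

  matchedTo-adjacent : ∀ {v w} → MatchedTo v w → Adj G v w
  matchedTo-adjacent (j , refl , refl) = end-adjacent j

  matchedTo-functional : ∀ {v w w′} → MatchedTo v w → MatchedTo v w′ → w ≡ w′
  matchedTo-functional (j , refl , refl) (j′ , end-j′≡end-j , refl) =
    cong (end ∘ swap) (end-injective {j} {j′} (sym end-j′≡end-j))

  matchedTo-injective : ∀ {v v′ w} → MatchedTo v w → MatchedTo v′ w → v ≡ v′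
  matchedTo-injective v~w v′~w = matchedTo-functional (matchedTo-sym v~w) (matchedTo-sym v′~w)

  covered? : ∀ v → Dec (Covered v)
  covered? v = map′ toCovered fromCovered (any? λ i → end (inj₁ i) ≟ v ⊎-dec end (inj₂ i) ≟ v)
    where
    toCovered : (∃[ i ] (end (inj₁ i) ≡ v ⊎ end (inj₂ i) ≡ v)) → Covered v
    toCovered (i , inj₁ eq) = _ , inj₁ i , eq , refl
    toCovered (i , inj₂ eq) = _ , inj₂ i , eq , refl

    fromCovered : Covered v → ∃[ i ] (end (inj₁ i) ≡ v ⊎ end (inj₂ i) ≡ v)
    fromCovered (_ , inj₁ i , eq , _) = i , inj₁ eq
    fromCovered (_ , inj₂ i , eq , _) = i , inj₂ eq

  covered : Subset n
  covered = tabulate (λ v → isYes (covered? v))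

  2m≤∣covered∣ : 2 * m ≤ ∣ covered ∣
  2m≤∣covered∣ = subst (_≤ ∣ covered ∣) (cong (m +_) (sym (ℕ.+-identityʳ m)))
    (k≤∣q∣-by-injection (end ∘ splitAt m) (splitAt-injective m ∘ end-injective)
      (λ i → ∈tabulate⁺ (fromWitness (_ , splitAt m i , refl , refl))))

  ∣S∣+2m≤n+∣N[S]∣ : ∀ {S} → Independent G S → ∣ S ∣ + 2 * m ≤ n + ∣ N G S ∣
  ∣S∣+2m≤n+∣N[S]∣ {S} S-independent = begin
    ∣ S ∣ + 2 * m                     ≤⟨ ℕ.+-monoʳ-≤ ∣ S ∣ 2m≤∣covered∣ ⟩
    ∣ S ∣ + ∣ covered ∣               ≡⟨ ∣p∪q∣+∣p∩q∣≡∣p∣+∣q∣ S covered ⟨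
    ∣ S ∪ covered ∣ + ∣ S ∩ covered ∣ ≤⟨ ℕ.+-mono-≤ (∣p∣≤n (S ∪ covered)) ∣S∩covered∣≤∣N[S]∣ ⟩
    n + ∣ N G S ∣                     ∎
    where
    open ℕ.≤-Reasoning
    ∣S∩covered∣≤∣N[S]∣ : ∣ S ∩ covered ∣ ≤ ∣ N G S ∣
    ∣S∩covered∣≤∣N[S]∣ = ∣p∣≤∣q∣-by-injection MatchedTo partner (λ _ _ → matchedTo-injective)
      where
      partner : ∀ {v} → v ∈ S ∩ covered → ∃[ w ] w ∈ N G S × MatchedTo v w
      partner v∈S∩covered with x∈p∩q⁻ S covered v∈S∩covered
      ... | v∈S , v∈covered with toWitness (∈tabulate⁻ v∈covered)
      ... | w , v~w = w , ∈N⁺ G v∈S (matchedTo-adjacent v~w) , v~w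

  module _ {S} (S-independent : Independent G S) (∣S∣+m≡n : ∣ S ∣ + m ≡ n) where

    private
      outer : Fin m → Fin m ⊎ Fin m
      outer i with end (inj₁ i) ∈? S
      ... | yes _ = inj₂ i
      ... | no  _ = inj₁ i

      outer-∉ : ∀ i → end (outer i) ∉ S
      outer-∉ i with end (inj₁ i) ∈? S
      ... | yes end₁∈S = λ end₂∈S → S-independent _ _ end₁∈S end₂∈S (end-adjacent (inj₁ i))
      ... | no  end₁∉S = end₁∉S

      edge∘outer : ∀ i → edge (outer i) ≡ i
      edge∘outer i with end (inj₁ i) ∈? S
      ... | yes _ = refl
      ... | no  _ = refl

      end∘outer-injective : Injective _≡_ _≡_ (end ∘ outer)
      end∘outer-injective {i} {i′} eq = begin
        i               ≡⟨ edge∘outer i ⟨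
        edge (outer i)  ≡⟨ cong edge (end-injective {outer i} {outer i′} eq) ⟩
        edge (outer i′) ≡⟨ edge∘outer i′ ⟩
        i′              ∎
        where open ≡-Reasoning

      outer-onto : ∀ {u} → u ∉ S → ∃[ i ] end (outer i) ≡ u
      outer-onto u∉S = injection⇒onto (end ∘ outer) end∘outer-injective
                         (x∉p⇒x∈∁p ∘ outer-∉) (∣p∣+k≡n⇒∣∁p∣≡k S ∣S∣+m≡n) (x∉p⇒x∈∁p u∉S)

    -- Counting: the m edges each have an end outside S, and there are exactly m vertices outside S.
    ∉⇒matched-into : ∀ {v} → v ∉ S → ∃[ w ] MatchedTo v w × w ∈ S
    ∉⇒matched-into v∉S with outer-onto v∉S
    ... | i , end[outer-i]≡v with end (swap (outer i)) ∈? S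
    ...   | yes w∈S = _ , (outer i , end[outer-i]≡v , refl) , w∈S
    ...   | no  w∉S with outer-onto w∉S
    ...     | i′ , end[outer-i′]≡w = contradiction swap[outer-i]≡outer-i (swap≢id (outer i))
      where
      outer-i′≡swap[outer-i] : outer i′ ≡ swap (outer i)
      outer-i′≡swap[outer-i] = end-injective {outer i′} {swap (outer i)} end[outer-i′]≡w

      i′≡i : i′ ≡ i
      i′≡i = begin
        i′                    ≡⟨ edge∘outer i′ ⟨
        edge (outer i′)       ≡⟨ cong edge outer-i′≡swap[outer-i] ⟩
        edge (swap (outer i)) ≡⟨ edge∘swap (outer i) ⟩
        edge (outer i)        ≡⟨ edge∘outer i ⟩
        i                     ∎
        where open ≡-Reasoning

      swap[outer-i]≡outer-i : swap (outer i) ≡ outer i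
      swap[outer-i]≡outer-i = trans (sym outer-i′≡swap[outer-i]) (cong outer i′≡i)

  module _ {a} (a+m≡n : a + m ≡ n) where

    ∉maximum⇒matched-into : ∀ {S v} → IsMaxIndep G a S → v ∉ S → ∃[ w ] MatchedTo v w × w ∈ S
    ∉maximum⇒matched-into (S-independent , ∣S∣≡a) =
      ∉⇒matched-into S-independent (trans (cong (_+ m) ∣S∣≡a) a+m≡n)

    module _ {C} (C-core : IsCore G a C) where

      core⊆maximum : ∀ {S v} → IsMaxIndep G a S → v ∈ C → v ∈ S
      core⊆maximum {S} {v} S-maximum v∈C = proj₁ (C-core v) v∈C S S-maximum

      core-independent : ∀ {S} → IsMaxIndep G a S → Independent G C
      core-independent S-maximum u v u∈C v∈C =
        proj₁ S-maximum u v (core⊆maximum S-maximum u∈C) (core⊆maximum S-maximum v∈C)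

      ∈N[core]⇒∉maximum : ∀ {S v} → IsMaxIndep G a S → v ∈ N G C → v ∉ S
      ∈N[core]⇒∉maximum S-maximum v∈NC v∈S with ∈N⁻ G v∈NC
      ... | u , u∈C , u~v = proj₁ S-maximum _ _ (core⊆maximum S-maximum u∈C) v∈S u~v

      uncovered⇒∈core : ∀ {v} → ¬ Covered v → v ∈ C
      uncovered⇒∈core {v} uncovered = proj₂ (C-core v) v∈maximum
        where
        v∈maximum : ∀ S → IsMaxIndep G a S → v ∈ S
        v∈maximum S S-maximum with v ∈? S
        ... | yes v∈S = v∈S
        ... | no  v∉S with ∉maximum⇒matched-into S-maximum v∉S
        ...   | w , v~w , _ = contradiction (w , v~w) uncovered

      matchedTo-N[core]⇒∈core : ∀ {v w} → v ∈ N G C → MatchedTo v w → w ∈ C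
      matchedTo-N[core]⇒∈core {w = w} v∈NC v~w = proj₂ (C-core w) w∈maximum
        where
        w∈maximum : ∀ S → IsMaxIndep G a S → w ∈ S
        w∈maximum S S-maximum with ∉maximum⇒matched-into S-maximum (∈N[core]⇒∉maximum S-maximum v∈NC)
        ... | w′ , v~w′ , w′∈S = subst (_∈ S) (matchedTo-functional v~w′ v~w) w′∈S

      -- Exchanging each vertex of T ∖ C for its partner, and fixing all other vertices, maps T ∪ N(C)
      -- injectively into C ∪ (V ∖ T).
      a+∣N[C]∣≤∣C∣+m : ∀ {T} → IsMaxIndep G a T → a + ∣ N G C ∣ ≤ ∣ C ∣ + m
      a+∣N[C]∣≤∣C∣+m {T} T-maximum@(T-independent , ∣T∣≡a) = begin
        a + ∣ N G C ∣     ≡⟨ cong (_+ ∣ N G C ∣) ∣T∣≡a ⟨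
        ∣ T ∣ + ∣ N G C ∣ ≡⟨ ∣p∪q∣≡∣p∣+∣q∣ T (N G C) T∩N[C]-empty ⟨
        ∣ T ∪ N G C ∣     ≤⟨ ∣p∣≤∣q∣-by-injection Exchange exchange-total exchange-injective ⟩
        ∣ C ∪ ∁ T ∣       ≤⟨ ∣p∪q∣≤∣p∣+∣q∣ C (∁ T) ⟩
        ∣ C ∣ + ∣ ∁ T ∣   ≡⟨ cong (∣ C ∣ +_) (∣p∣+k≡n⇒∣∁p∣≡k T (trans (cong (_+ m) ∣T∣≡a) a+m≡n)) ⟩
        ∣ C ∣ + m         ∎
        where
        open ℕ.≤-Reasoning

        T∩N[C]-empty : Empty (T ∩ N G C)
        T∩N[C]-empty (v , v∈T∩NC) with x∈p∩q⁻ T (N G C) v∈T∩NC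
        ... | v∈T , v∈NC = ∈N[core]⇒∉maximum T-maximum v∈NC v∈T

        Exchange : Fin n → Fin n → Set
        Exchange v w = (v ∈ T × v ∉ C × MatchedTo v w) ⊎ v ≡ w

        partner∉T : ∀ {v w} → v ∈ T → MatchedTo v w → w ∉ T
        partner∉T v∈T v~w w∈T = T-independent _ _ v∈T w∈T (matchedTo-adjacent v~w)

        exchanged∉T∪N[C] : ∀ {v w} → v ∈ T → v ∉ C → MatchedTo v w → w ∉ T ∪ N G C
        exchanged∉T∪N[C] v∈T v∉C v~w w∈T∪NC with x∈p∪q⁻ T (N G C) w∈T∪NC
        ... | inj₁ w∈T  = partner∉T v∈T v~w w∈T
        ... | inj₂ w∈NC = v∉C (matchedTo-N[core]⇒∈core w∈NC (matchedTo-sym v~w))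

        exchange-total : ∀ {v} → v ∈ T ∪ N G C → ∃[ w ] w ∈ C ∪ ∁ T × Exchange v w
        exchange-total {v} _ with v ∈? C
        ... | yes v∈C = v , x∈p∪q⁺ (inj₁ v∈C) , inj₂ refl
        ... | no  v∉C with v ∈? T
        ...   | no  v∉T = v , x∈p∪q⁺ (inj₂ (x∉p⇒x∈∁p v∉T)) , inj₂ refl
        ...   | yes v∈T with covered? v
        ...     | no  uncovered = contradiction (uncovered⇒∈core uncovered) v∉C
        ...     | yes (w , v~w) =
                    w , x∈p∪q⁺ (inj₂ (x∉p⇒x∈∁p (partner∉T v∈T v~w))) , inj₁ (v∈T , v∉C , v~w)

        exchange-injective : ∀ {v v′ w} → v ∈ T ∪ N G C → v′ ∈ T ∪ N G C →
                             Exchange v w → Exchange v′ w → v ≡ v′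
        exchange-injective _ _ (inj₁ (_ , _ , v~w)) (inj₁ (_ , _ , v′~w)) = matchedTo-injective v~w v′~w
        exchange-injective _ _ (inj₂ v≡w) (inj₂ v′≡w) = trans v≡w (sym v′≡w)
        exchange-injective _ v′∈T∪NC (inj₁ (v∈T , v∉C , v~w)) (inj₂ refl) =
          contradiction v′∈T∪NC (exchanged∉T∪N[C] v∈T v∉C v~w)
        exchange-injective v∈T∪NC _ (inj₂ refl) (inj₁ (v′∈T , v′∉C , v′~w)) =
          contradiction v∈T∪NC (exchanged∉T∪N[C] v′∈T v′∉C v′~w)

-- Opened only now: with the prefix +_ in scope, ∣ p ∣ + ∣ q ∣ above would not parse.
open import Data.Integer using (ℤ; +_; _-_; _⊖_)
import Data.Integer as ℤ using (_≤_)
import Data.Integer.Properties as ℤ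

+m-+n≤+p-+q : ∀ m n p q → m + q ≤ p + n → + m - + n ℤ.≤ + p - + q
+m-+n≤+p-+q m n p q m+q≤p+n = begin
  + m - + n         ≡⟨ ℤ.m-n≡m⊖n m n ⟩
  m ⊖ n             ≡⟨ ℤ.+-cancelˡ-⊖ q m n ⟨
  (q + m) ⊖ (q + n) ≤⟨ ℤ.⊖-monoˡ-≤ (q + n) (subst (_≤ p + n) (ℕ.+-comm m q) m+q≤p+n) ⟩
  (p + n) ⊖ (q + n) ≡⟨ cong₂ _⊖_ (ℕ.+-comm p n) (ℕ.+-comm q n) ⟩
  (n + p) ⊖ (n + q) ≡⟨ ℤ.+-cancelˡ-⊖ n p q ⟩
  p ⊖ q             ≡⟨ ℤ.m-n≡m⊖n p q ⟨
  + p - + q         ∎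
  where open ℤ.≤-Reasoning

+m-+n≡+p-+q : ∀ m n p q → m + q ≡ p + n → + m - + n ≡ + p - + q
+m-+n≡+p-+q m n p q m+q≡p+n = ℤ.≤-antisym (+m-+n≤+p-+q m n p q (ℕ.≤-reflexive m+q≡p+n))
                                          (+m-+n≤+p-+q p q m n (ℕ.≤-reflexive (sym m+q≡p+n)))

α-μ≡def : ∀ a m {n} → a + m ≡ n → + a - + m ≡ + n - + (2 * m)
α-μ≡def a m {n} a+m≡n = +m-+n≡+p-+q a m n (2 * m) (begin
  a + 2 * m   ≡⟨ cong (λ k → a + (m + k)) (ℕ.+-identityʳ m) ⟩
  a + (m + m) ≡⟨ ℕ.+-assoc a m m ⟨
  a + m + m   ≡⟨ cong (_+ m) a+m≡n ⟩
  n + m       ∎)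
  where open ≡-Reasoning

theorem5 : ∀ {n : ℕ} (G : Graph n) (a m : ℕ) (d : ℤ) (C : Subset n)
           → IsAlpha G a → IsMu G m → IsCritDiff G d → IsCore G a C
           → a + m ≡ n
           → (d ≡ + ∣ C ∣ - + ∣ N G C ∣)
             × (+ ∣ C ∣ - + ∣ N G C ∣ ≡ + a - + m)
             × (+ a - + m ≡ + n - + (2 * m))
theorem5 {n} G a m d C ((T , T-maximum) , _) ((e , M) , _)
         ((S , S-independent , S-attains-d) , d-maximal) C-core a+m≡n = d≡c , c≡α-μ , α-μ≡def a m a+m≡n
  where
  open Matching G e M

  d≤α-μ : d ℤ.≤ + a - + m
  d≤α-μ = subst₂ ℤ._≤_ S-attains-d (sym (α-μ≡def a m a+m≡n))
            (+m-+n≤+p-+q ∣ S ∣ ∣ N G S ∣ n (2 * m) (∣S∣+2m≤n+∣N[S]∣ S-independent))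

  α-μ≤c : + a - + m ℤ.≤ + ∣ C ∣ - + ∣ N G C ∣
  α-μ≤c = +m-+n≤+p-+q a m ∣ C ∣ ∣ N G C ∣ (a+∣N[C]∣≤∣C∣+m a+m≡n C-core T-maximum)

  c≤d : + ∣ C ∣ - + ∣ N G C ∣ ℤ.≤ d
  c≤d = d-maximal C (core-independent a+m≡n C-core T-maximum)

  d≡c : d ≡ + ∣ C ∣ - + ∣ N G C ∣
  d≡c = ℤ.≤-antisym (ℤ.≤-trans d≤α-μ α-μ≤c) c≤d

  c≡α-μ : + ∣ C ∣ - + ∣ N G C ∣ ≡ + a - + m
  c≡α-μ = ℤ.≤-antisym (ℤ.≤-trans c≤d d≤α-μ) α-μ≤c
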